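{- Let $\mathbf{s}=(s_i)_{i\in\omega}$ be a sequence of pairwise disjoint elements of $\mathbb{F}$ such that for every $n$ there exist $i_0<\dots<i_n$ for which the meshing graph $G_{(s_{i_0},\ldots,s_{i_n})}$ is complete. The notion of being $\mathbf{s}$-meshed is partition regular: $\mathbb{F}$ is $\mathbf{s}$-meshed, and whenever an $\mathbf{s}$-meshed set $A$ is written as $A=A_0\cup A_1$, at least one of $A_0,A_1$ is $\mathbf{s}$-meshed. In particular, every $\mathbf{s}$-meshed set is contained in an ultrafilter on $\mathbb{F}$ all of whose members are $\mathbf{s}$-meshed.
   Context: $\mathbb{F}$ denotes the set of nonempty finite subsets of $\omega$. For $s,t\in\mathbb{F}$ write $s<t$ iff $\max(s)<\min(t)$, and say $s,t$ mesh, $s\sqcap t$, if neither $s<t$ nor $t<s$. For a sequence $\mathbf{x}=(x_i)_{i<N}$ ($N\le\omega$) of pairwise disjoint elements of $\mathbb{F}$, $FU(\mathbf{x})=\{\bigcup_{i\in v}x_i : v \text{ a nonempty finite subset of } N\}$, and $\mathbf{y}\sqsubseteq\mathbf{x}$ means $FU(\mathbf{y})\subseteq FU(\mathbf{x})$. For $z\in FU(\mathbf{s})$, "$s_n\subseteq z$" means $n$ belongs to the unique finite set $v$ with $z=\bigcup_{i\in v}s_i$. Given a sequence $\mathbf{t}=(t_j)_{j<K}$ of pairwise disjoint elements with $\mathbf{t}\sqsubseteq\mathbf{s}$, the meshing graph $G_{\mathbf{t}}$ has vertex set $\{t_j:j<K\}$ and an edge $\{t_i,t_j\}$ whenever there are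 $s_n\subseteq t_i$, $s_m\subseteq t_j$ with $s_n\sqcap s_m$. A set $A\subseteq\mathbb{F}$ is $\mathbf{s}$-meshed if for every $n\in\omega$ there is a sequence $\mathbf{t}=(t_i)_{i<n}$ of pairwise disjoint elements of $\mathbb{F}$ with $FU(\mathbf{t})\subseteq FU(\mathbf{s})\cap A$ and $G_{\mathbf{t}}$ a complete graph. -}

module Defs where

open import Level using (0ℓ)
open import Data.Nat using (ℕ; _<_)
open import Data.List using (List; []; _∷_)
open import Data.List.Relation.Unary.Linked using (Linked)
open import Data.List.Membership.Propositional using (_∈_)
open import Data.Fin using (Fin)
import Data.Fin as Fin
open import Data.Fin.Subset using (Subset; Nonempty)
import Data.Fin.Subset as FS
open import Data.Product using (Σ; _×_)
open import Data.Sum using (_⊎_)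
open import Data.Unit using (⊤)
open import Data.Empty using (⊥)
open import Relation.Nullary using (¬_)
open import Relation.Binary.PropositionalEquality using (_≢_)
open import Function.Bundles using (_⇔_)

-- 𝔽 : nonempty finite subsets of ω, represented canonically as a
-- strictly increasing nonempty list  hd < x₁ < x₂ < …

record 𝔽 : Set where
  constructor mkF
  field
    hd  : ℕ
    tl  : List ℕ
    inc : Linked _<_ (hd ∷ tl)
open 𝔽 public

elems : 𝔽 → List ℕ
elems s = hd s ∷ tl s

_∈F_ : ℕ → 𝔽 → Set
k ∈F s = k ∈ elems s

minF : 𝔽 → ℕ
minF s = hd s

lastFrom : ℕ → List ℕ → ℕ
lastFrom h []       = h
lastFrom h (x ∷ xs) = lastFrom x xs

maxF : 𝔽 → ℕ
maxF s = lastFrom (hd s) (tl s)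

_<F_ : 𝔽 → 𝔽 → Set
s <F t = maxF s < minF t

_⊓_ : 𝔽 → 𝔽 → Set
s ⊓ t = ¬ (s <F t) × ¬ (t <F s)

PairwiseDisjoint : {I : Set} → (I → 𝔽) → Set
PairwiseDisjoint {I} x = (i j : I) → i ≢ j → (k : ℕ) → k ∈F x i → k ∈F x j → ⊥

IsUnion : {I : Set} → (I → 𝔽) → (I → Set) → 𝔽 → Set
IsUnion {I} x V z = (k : ℕ) → (k ∈F z) ⇔ Σ I (λ i → V i × k ∈F x i)

InFU : (ℕ → 𝔽) → 𝔽 → Set
InFU s z = Σ 𝔽 (λ v → IsUnion s (λ i → i ∈F v) z)

InFUFin : {K : ℕ} → (Fin K → 𝔽) → 𝔽 → Set
InFUFin {K} t z = Σ (Subset K) (λ V → Nonempty V × IsUnion t (λ i → i FS.∈ V) z)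

-- "s_n ⊆ z": n belongs to the index set v with z = ⋃_{i∈v} s_i
_⊆[_]_ : ℕ → (ℕ → 𝔽) → 𝔽 → Set
n ⊆[ s ] z = Σ 𝔽 (λ v → IsUnion s (λ i → i ∈F v) z × n ∈F v)

CompleteMeshGraph : {K : ℕ} → (ℕ → 𝔽) → (Fin K → 𝔽) → Set
CompleteMeshGraph {K} s t =
  (i j : Fin K) → i ≢ j →
  Σ ℕ (λ n → Σ ℕ (λ m → n ⊆[ s ] t i × m ⊆[ s ] t j × (s n ⊓ s m)))

StrictlyIncreasing : {K : ℕ} → (Fin K → ℕ) → Set
StrictlyIncreasing {K} f = (a b : Fin K) → a Fin.< b → f a < f b

SubsetF : Set₁
SubsetF = 𝔽 → Set

IsMeshed : (ℕ → 𝔽) → SubsetF → Set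
IsMeshed s A =
  (n : ℕ) → Σ (Fin n → 𝔽) (λ t →
    PairwiseDisjoint t ×
    ((z : 𝔽) → InFUFin t z → InFU s z × A z) ×
    CompleteMeshGraph s t)

_⊆ˢ_ : SubsetF → SubsetF → Set
B ⊆ˢ C = (z : 𝔽) → B z → C z

_∩ˢ_ : SubsetF → SubsetF → SubsetF
(B ∩ˢ C) z = B z × C z

∁ˢ : SubsetF → SubsetF
∁ˢ B z = ¬ B z

record IsFilter (Φ : SubsetF → Set) : Set₁ where
  field
    full   : Φ (λ _ → ⊤)
    proper : ¬ Φ (λ _ → ⊥)
    inter  : (B C : SubsetF) → Φ B → Φ C → Φ (B ∩ˢ C)
    upward : (B C : SubsetF) → B ⊆ˢ C → Φ B → Φ C

IsUltrafilter : (SubsetF → Set) → Set₁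
IsUltrafilter U = IsFilter U × ((B : SubsetF) → U B ⊎ U (∁ˢ B))

UltrafilterLemma : Set₁
UltrafilterLemma =
  (Φ : SubsetF → Set) → IsFilter Φ →
  Σ (SubsetF → Set) (λ U → IsUltrafilter U × ((B : SubsetF) → Φ B → U B))

module Submission where

-- The heart of the proof is Folkman's theorem (finite unions version): for all a, b
-- there is N such that for every 2-colouring of the subsets of Fin N there are a
-- disjoint nonempty blocks all of whose nonempty unions have colour 0, or b such
-- blocks with colour 1.  It is proved constructively in two stages:
--   * a cube lemma: every r-colouring of Subset N (N large) is constant on a
--     "cube" { F ∪ ⋃_{j∈u} W_j | u ⊆ d }, by induction on d with a pigeonhole
--     argument on colour profiles of initial segments;
--   * Folkman's theorem by induction on a + b, applying the cube lemma and recursing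
--     into the blocks of a monochromatic cube.
-- For s-meshed sets, a witness of length N for A = A₀ ∪ A₁ is coarsened along the
-- Folkman blocks of the colouring "all unions over V lie in A₀", giving witnesses
-- for A₀ or for A₁; excluded middle then yields partition regularity.  𝔽 is s-meshed
-- by the hypothesis on s, and the ultrafilter follows from the ultrafilter lemma
-- applied to the filter { B | A ∖ B is not s-meshed }.

open import Defs
open import Level using (0ℓ)
open import Axiom.ExcludedMiddle using (ExcludedMiddle)
open import Data.Bool using (true; false; _∨_)
open import Data.Empty using (⊥; ⊥-elim)
open import Data.Unit using (⊤; tt)
open import Data.Fin using (Fin; zero; suc; toℕ; fromℕ<; _↑ˡ_; _↑ʳ_; combine; inject₁)
open import Data.Fin.Properties
  using (combine-injective; pigeonhole; toℕ<n; toℕ-fromℕ<; ↑ˡ-injective; ↑ʳ-injective)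
import Data.Fin.Properties as Fin
open import Data.Fin.Subset using (Subset; Nonempty; _∈_; _∪_; ⁅_⁆) renaming (⊥ to ∅)
open import Data.Fin.Subset.Properties
  using (∉⊥; ∪-assoc; ∪-identityˡ; ∪-identityʳ; x∈p∪q⁺; x∈p∪q⁻; ⊆-antisym; x∈⁅x⁆; x∈⁅y⁆⇒x≡y)
open import Data.List using (List; []; _∷_; length; map)
import Data.List as List
open import Data.Nat.ListAction using (sum)
import Data.List.Relation.Unary.Any as Any
open import Data.List.Relation.Unary.Any.Properties using (¬Any[])
open import Data.List.Relation.Unary.AllPairs using (AllPairs)
open import Data.List.Relation.Unary.Linked using (Linked; []; [-]; _∷_)
import Data.List.Membership.Propositional as List
open import Data.List.Membership.Propositional.Properties
  using (∈-map⁺; ∈-++⁺ˡ; ∈-++⁺ʳ; ∈-filter⁺; ∈-filter⁻; ∈-upTo⁺; ∈-tabulate⁺)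
open import Data.List.Relation.Unary.AllPairs.Properties using (applyUpTo⁺₁; filter⁺)
open import Data.List.Relation.Unary.Linked.Properties using (AllPairs⇒Linked)
open import Axiom.DoubleNegationElimination using (em⇒dne)
import Data.Nat as ℕ
open import Data.Nat using (ℕ; zero; suc; _+_; _<_; _≤_; _^_; s≤s; s≤s⁻¹)
open import Data.Nat.Properties
  using ( m≤m+n; m≤n+m; ≤-trans; n<1+n; <⇒≤; <-trans; <-irrefl; <-irrelevant; <-≤-trans
        ; ≤-reflexive; ≮⇒≥; _<?_; _≤?_)
open import Data.Product using (Σ; _×_; _,_; proj₁; proj₂; ∃-syntax; map₂)
open import Data.Sum using (_⊎_; inj₁; inj₂; [_,_])
open import Data.Vec using ([]; _∷_; _++_; tabulate; here; there)
open import Data.Vec.Properties using (zipWith-++; lookup∘tabulate; lookup⇒[]=; []=⇒lookup)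
open import Function using (_∘_; id; case_of_)
open import Function.Bundles using (_⇔_; mk⇔; Equivalence)
open import Function.Definitions using (Injective)
open import Relation.Binary.PropositionalEquality
  using (_≡_; _≢_; refl; sym; trans; cong; cong₂; subst; module ≡-Reasoning)
open import Relation.Binary using (tri<; tri≈; tri>)
open import Relation.Nullary using (¬_; yes; no; does)
open import Relation.Nullary.Decidable using (dec-true; _×-dec_)
open import Relation.Unary using (Decidable)

open Equivalence using (to; from)

head<tail : ∀ {x y xs} → Linked _<_ (x ∷ xs) → y List.∈ xs → x < y
head<tail (x<y ∷ _) (Any.here refl) = x<y
head<tail (x<y ∷ l) (Any.there p)   = <-trans x<y (head<tail l p)

tail-linked : ∀ {x xs} → Linked _<_ (x ∷ xs) → Linked _<_ xs
tail-linked [-]     = []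
tail-linked (_ ∷ l) = l

Linked-irrelevant : ∀ {xs} (p q : Linked _<_ xs) → p ≡ q
Linked-irrelevant []      []       = refl
Linked-irrelevant [-]     [-]      = refl
Linked-irrelevant (r ∷ p) (r′ ∷ q) = cong₂ _∷_ (<-irrelevant r r′) (Linked-irrelevant p q)

sorted-ext : ∀ {xs ys} → Linked _<_ xs → Linked _<_ ys →
             (∀ {k} → k List.∈ xs → k List.∈ ys) → (∀ {k} → k List.∈ ys → k List.∈ xs) → xs ≡ ys
sorted-ext {[]}     {[]}     _  _  _ _ = refl
sorted-ext {[]}     {y ∷ _}  _  _  _ g = case g (Any.here refl) of λ ()
sorted-ext {x ∷ _}  {[]}     _  _  f _ = case f (Any.here refl) of λ ()
sorted-ext {x ∷ xs} {y ∷ ys} lx ly f g =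
  cong₂ _∷_ x≡y (sorted-ext (tail-linked lx) (tail-linked ly) f′ g′)
  where
  -- the heads are the least members
  x≡y : x ≡ y
  x≡y with f (Any.here refl) | g (Any.here refl)
  ... | Any.here e  | _           = e
  ... | Any.there _ | Any.here e  = sym e
  ... | Any.there p | Any.there q = ⊥-elim (<-irrefl refl (<-trans (head<tail ly p) (head<tail lx q)))
  f′ : ∀ {k} → k List.∈ xs → k List.∈ ys
  f′ m with f (Any.there m)
  ... | Any.here refl = ⊥-elim (<-irrefl x≡y (head<tail lx m))
  ... | Any.there m′  = m′
  g′ : ∀ {k} → k List.∈ ys → k List.∈ xs
  g′ m with g (Any.there m)
  ... | Any.here refl = ⊥-elim (<-irrefl (sym x≡y) (head<tail ly m))
  ... | Any.there m′  = m′

𝔽-ext : (a b : 𝔽) → (∀ {k} → k ∈F a → k ∈F b) → (∀ {k} → k ∈F b → k ∈F a) → a ≡ b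
𝔽-ext (mkF h t p) (mkF h′ t′ q) f g with sorted-ext p q f g
... | refl = cong (mkF h t) (Linked-irrelevant p q)

IsUnion-unique : ∀ {I : Set} {x : I → 𝔽} {V : I → Set} {z z′ : 𝔽} →
                 IsUnion x V z → IsUnion x V z′ → z ≡ z′
IsUnion-unique u u′ = 𝔽-ext _ _ (λ {k} m → from (u′ k) (to (u k) m)) (λ {k} m → from (u k) (to (u′ k) m))

-- Colour profiles: a list-indexed family of colours in Fin r is coded
-- injectively by a single colour in Fin (r ^ length L).
encode : ∀ {r} {A : Set} (L : List A) → (A → Fin r) → Fin (r ^ length L)
encode []      f = zero
encode (x ∷ L) f = combine (f x) (encode L f)

encode-injective : ∀ {r} {A : Set} (L : List A) (f g : A → Fin r) →
                   encode L f ≡ encode L g → ∀ {a} → a List.∈ L → f a ≡ g a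
encode-injective (x ∷ L) f g e (Any.here refl) = proj₁ (combine-injective (f x) _ (g x) _ e)
encode-injective (x ∷ L) f g e (Any.there m)   =
  encode-injective L f g (proj₂ (combine-injective (f x) _ (g x) _ e)) m

allSubsets : ∀ n → List (Subset n)
allSubsets zero    = [] ∷ []
allSubsets (suc n) = map (true ∷_) (allSubsets n) List.++ map (false ∷_) (allSubsets n)

∈-allSubsets : ∀ {n} (X : Subset n) → X List.∈ allSubsets n
∈-allSubsets []          = Any.here refl
∈-allSubsets (true ∷ X)  = ∈-++⁺ˡ (∈-map⁺ (true ∷_) (∈-allSubsets X))
∈-allSubsets (false ∷ X) = ∈-++⁺ʳ _ (∈-map⁺ (false ∷_) (∈-allSubsets X))

Disjoint : ∀ {n} → Subset n → Subset n → Set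
Disjoint X Y = ∀ {a} → a ∈ X → a ∈ Y → ⊥

module _ {n : ℕ} where

  ∅-disjoint : {X : Subset n} → Disjoint ∅ X
  ∅-disjoint a∈∅ _ = ∉⊥ a∈∅

  disjoint-∅ : {X : Subset n} → Disjoint X ∅
  disjoint-∅ _ a∈∅ = ∉⊥ a∈∅

  Disjoint-sym : {X Y : Subset n} → Disjoint X Y → Disjoint Y X
  Disjoint-sym d p q = d q p

  Disjoint-∪ : {X Y Z : Subset n} → Disjoint X Z → Disjoint Y Z → Disjoint (X ∪ Y) Z
  Disjoint-∪ {X} {Y} dX dY p q with x∈p∪q⁻ X Y p
  ... | inj₁ p′ = dX p′ q
  ... | inj₂ p′ = dY p′ q

Disjoint-++ : ∀ {m n} (X X′ : Subset m) (Y Y′ : Subset n) →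
              Disjoint X X′ → Disjoint Y Y′ → Disjoint (X ++ Y) (X′ ++ Y′)
Disjoint-++ []      []       Y Y′ dX dY p         q         = dY p q
Disjoint-++ (_ ∷ X) (_ ∷ X′) Y Y′ dX dY here      here      = dX here here
Disjoint-++ (_ ∷ X) (_ ∷ X′) Y Y′ dX dY (there p) (there q) =
  Disjoint-++ X X′ Y Y′ (λ p′ q′ → dX (there p′) (there q′)) dY p q

∈-++ˡ : ∀ {m n} {X : Subset m} {Y : Subset n} {a} → a ∈ X → (a ↑ˡ n) ∈ X ++ Y
∈-++ˡ here      = here
∈-++ˡ (there p) = there (∈-++ˡ p)

∈-++ʳ : ∀ {m n} (X : Subset m) {Y : Subset n} {a} → a ∈ Y → (m ↑ʳ a) ∈ X ++ Y
∈-++ʳ []      p = p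
∈-++ʳ (_ ∷ X) p = there (∈-++ʳ X p)

∪-++ : ∀ {m n} (X X′ : Subset m) (Y Y′ : Subset n) → (X ++ Y) ∪ (X′ ++ Y′) ≡ (X ∪ X′) ++ (Y ∪ Y′)
∪-++ X X′ Y Y′ = zipWith-++ _∨_ X Y X′ Y′

∅-++ : ∀ m n → ∅ {m} ++ ∅ {n} ≡ ∅
∅-++ zero    n = refl
∅-++ (suc m) n = cong (false ∷_) (∅-++ m n)

⋃[_]_ : ∀ {d n} → (Fin d → Subset n) → Subset d → Subset n
⋃[ W ] []          = ∅
⋃[ W ] (true ∷ u)  = W zero ∪ ⋃[ W ∘ suc ] u
⋃[ W ] (false ∷ u) = ⋃[ W ∘ suc ] u

∈⋃⁺ : ∀ {d n} (W : Fin d → Subset n) {u : Subset d} {j a} → j ∈ u → a ∈ W j → a ∈ ⋃[ W ] u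
∈⋃⁺ W {true ∷ u}  here      a∈W = x∈p∪q⁺ (inj₁ a∈W)
∈⋃⁺ W {true ∷ u}  (there j) a∈W = x∈p∪q⁺ (inj₂ (∈⋃⁺ (W ∘ suc) j a∈W))
∈⋃⁺ W {false ∷ u} (there j) a∈W = ∈⋃⁺ (W ∘ suc) j a∈W

∈⋃⁻ : ∀ {d n} (W : Fin d → Subset n) (u : Subset d) {a} → a ∈ ⋃[ W ] u → ∃[ j ] (j ∈ u × a ∈ W j)
∈⋃⁻ W []          a∈∅ = ⊥-elim (∉⊥ a∈∅)
∈⋃⁻ W (false ∷ u) a∈⋃ with ∈⋃⁻ (W ∘ suc) u a∈⋃
... | j , j∈u , a∈W = suc j , there j∈u , a∈W
∈⋃⁻ W (true ∷ u)  a∈⋃ with x∈p∪q⁻ (W zero) _ a∈⋃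
... | inj₁ a∈W = zero , here , a∈W
... | inj₂ a∈⋃′ with ∈⋃⁻ (W ∘ suc) u a∈⋃′
...   | j , j∈u , a∈W = suc j , there j∈u , a∈W

⋃-cong : ∀ {d n} {W W′ : Fin d → Subset n} → (∀ j → W j ≡ W′ j) → ∀ u → ⋃[ W ] u ≡ ⋃[ W′ ] u
⋃-cong e []          = refl
⋃-cong e (true ∷ u)  = cong₂ _∪_ (e zero) (⋃-cong (e ∘ suc) u)
⋃-cong e (false ∷ u) = ⋃-cong (e ∘ suc) u

⋃-∅ : ∀ {d n} (W : Fin d → Subset n) → ⋃[ W ] ∅ ≡ ∅
⋃-∅ {zero}  W = refl
⋃-∅ {suc d} W = ⋃-∅ (W ∘ suc)

⋃-⁅⁆ : ∀ {d n} (W : Fin d → Subset n) (j : Fin d) → ⋃[ W ] ⁅ j ⁆ ≡ W j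
⋃-⁅⁆ W zero    = trans (cong (W zero ∪_) (⋃-∅ (W ∘ suc))) (∪-identityʳ (W zero))
⋃-⁅⁆ W (suc j) = ⋃-⁅⁆ (W ∘ suc) j

⋃-⋃ : ∀ {d e n} (W : Fin d → Subset n) (Y : Fin e → Subset d) (v : Subset e) →
      ⋃[ ⋃[ W ]_ ∘ Y ] v ≡ ⋃[ W ] (⋃[ Y ] v)
⋃-⋃ W Y v = ⊆-antisym ⊆ ⊇
  where
  ⊆ : ∀ {a} → a ∈ ⋃[ ⋃[ W ]_ ∘ Y ] v → a ∈ ⋃[ W ] (⋃[ Y ] v)
  ⊆ a∈ with ∈⋃⁻ (⋃[ W ]_ ∘ Y) v a∈
  ... | j , j∈v , a∈Wj with ∈⋃⁻ W (Y j) a∈Wj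
  ...   | p , p∈Yj , a∈Wp = ∈⋃⁺ W (∈⋃⁺ Y j∈v p∈Yj) a∈Wp
  ⊇ : ∀ {a} → a ∈ ⋃[ W ] (⋃[ Y ] v) → a ∈ ⋃[ ⋃[ W ]_ ∘ Y ] v
  ⊇ a∈ with ∈⋃⁻ W (⋃[ Y ] v) a∈
  ... | p , p∈⋃ , a∈Wp with ∈⋃⁻ Y v p∈⋃
  ...   | j , j∈v , p∈Yj = ∈⋃⁺ (⋃[ W ]_ ∘ Y) j∈v (∈⋃⁺ W p∈Yj a∈Wp)

⋃-++∅ : ∀ {d m n} (W : Fin d → Subset m) (u : Subset d) →
        ⋃[ (λ j → W j ++ ∅ {n}) ] u ≡ ⋃[ W ] u ++ ∅
⋃-++∅ {m = m} {n} W []  = sym (∅-++ m n)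
⋃-++∅ W (false ∷ u) = ⋃-++∅ (W ∘ suc) u
⋃-++∅ W (true ∷ u)  = begin
  (W zero ++ ∅) ∪ ⋃[ (λ j → W (suc j) ++ ∅) ] u
    ≡⟨ cong ((W zero ++ ∅) ∪_) (⋃-++∅ (W ∘ suc) u) ⟩
  (W zero ++ ∅) ∪ (⋃[ W ∘ suc ] u ++ ∅)
    ≡⟨ ∪-++ (W zero) _ ∅ ∅ ⟩
  (W zero ∪ ⋃[ W ∘ suc ] u) ++ (∅ ∪ ∅)
    ≡⟨ cong ((W zero ∪ ⋃[ W ∘ suc ] u) ++_) (∪-identityˡ ∅) ⟩
  (W zero ∪ ⋃[ W ∘ suc ] u) ++ ∅
    ∎
  where open ≡-Reasoning

record Blocks {d n : ℕ} (W : Fin d → Subset n) : Set where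
  field
    nonempty : ∀ j → Nonempty (W j)
    disjoint : ∀ {i j} → i ≢ j → Disjoint (W i) (W j)
open Blocks

Blocks-∘ : ∀ {d e n} {W : Fin d → Subset n} → Blocks W →
           (g : Fin e → Fin d) → Injective _≡_ _≡_ g → Blocks (W ∘ g)
Blocks-∘ bW g g-inj = record
  { nonempty = nonempty bW ∘ g
  ; disjoint = λ i≢j → disjoint bW (i≢j ∘ g-inj) }

Blocks-⁅⁆ : ∀ {d e} (h : Fin e → Fin d) → Injective _≡_ _≡_ h → Blocks (⁅_⁆ ∘ h)
Blocks-⁅⁆ h h-inj = record
  { nonempty = λ j → h j , x∈⁅x⁆ (h j)
  ; disjoint = λ i≢j p q → i≢j (h-inj (trans (sym (x∈⁅y⁆⇒x≡y _ p)) (x∈⁅y⁆⇒x≡y _ q))) }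

⋃-nonempty : ∀ {d n} {W : Fin d → Subset n} → Blocks W → ∀ {u} → Nonempty u → Nonempty (⋃[ W ] u)
⋃-nonempty {W = W} bW (j , j∈u) = proj₁ (nonempty bW j) , ∈⋃⁺ W j∈u (proj₂ (nonempty bW j))

Blocks-⋃ : ∀ {d e n} {W : Fin d → Subset n} {Y : Fin e → Subset d} →
           Blocks W → Blocks Y → Blocks (⋃[ W ]_ ∘ Y)
Blocks-⋃ {W = W} {Y} bW bY = record { nonempty = λ j → ⋃-nonempty bW (nonempty bY j) ; disjoint = apart }
  where
  apart : ∀ {i j} → i ≢ j → Disjoint (⋃[ W ] Y i) (⋃[ W ] Y j)
  apart {i} {j} i≢j p q with ∈⋃⁻ W (Y i) p | ∈⋃⁻ W (Y j) q
  ... | x , x∈Yi , a∈Wx | y , y∈Yj , a∈Wy with x Fin.≟ y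
  ...   | yes refl = disjoint bY i≢j x∈Yi y∈Yj
  ...   | no x≢y   = disjoint bW x≢y a∈Wx a∈Wy

record Cube (N d : ℕ) : Set where
  field
    base          : Subset N
    block         : Fin d → Subset N
    blocks        : Blocks block
    base-disjoint : ∀ j → Disjoint base (block j)

  point : Subset d → Subset N
  point u = base ∪ ⋃[ block ] u
open Cube

Monochromatic : ∀ {N d r} → (Subset N → Fin r) → Cube N d → Set
Monochromatic c C = ∀ u → c (point C u) ≡ c (base C)

CubeBound : ℕ → ℕ → ℕ → Set
CubeBound d r N = (c : Subset N → Fin r) → Σ (Cube N d) (Monochromatic c)

module Stack {n d R : ℕ} (C : Cube n d) (S T : Subset R) (S#T : Disjoint S T) (T≠∅ : Nonempty T) where

  stacked-block : Fin (suc d) → Subset (n + R)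
  stacked-block zero    = ∅ ++ T
  stacked-block (suc j) = block C j ++ ∅

  stacked-blocks : Blocks stacked-block
  stacked-blocks = record { nonempty = ne ; disjoint = apart }
    where
    ne : ∀ j → Nonempty (stacked-block j)
    ne zero    = n ↑ʳ proj₁ T≠∅ , ∈-++ʳ ∅ (proj₂ T≠∅)
    ne (suc j) = proj₁ (nonempty (blocks C) j) ↑ˡ R , ∈-++ˡ (proj₂ (nonempty (blocks C) j))
    apart : ∀ {i j} → i ≢ j → Disjoint (stacked-block i) (stacked-block j)
    apart {zero}  {zero}  i≢j = ⊥-elim (i≢j refl)
    apart {zero}  {suc j} _   = Disjoint-++ ∅ _ T ∅ ∅-disjoint disjoint-∅
    apart {suc i} {zero}  _   = Disjoint-++ _ ∅ ∅ T disjoint-∅ ∅-disjoint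
    apart {suc i} {suc j} i≢j = Disjoint-++ _ _ ∅ ∅ (disjoint (blocks C) (i≢j ∘ cong suc)) ∅-disjoint

  stacked : Cube (n + R) (suc d)
  stacked = record
    { base          = base C ++ S
    ; block         = stacked-block
    ; blocks        = stacked-blocks
    ; base-disjoint = λ { zero → Disjoint-++ (base C) ∅ S T disjoint-∅ S#T
                        ; (suc j) → Disjoint-++ (base C) _ S ∅ (base-disjoint C j) disjoint-∅ } }

  point-without : ∀ u → point stacked (false ∷ u) ≡ point C u ++ S
  point-without u = begin
    (base C ++ S) ∪ ⋃[ stacked-block ∘ suc ] u  ≡⟨ cong ((base C ++ S) ∪_) (⋃-++∅ (block C) u) ⟩
    (base C ++ S) ∪ (⋃[ block C ] u ++ ∅)      ≡⟨ ∪-++ (base C) _ S ∅ ⟩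
    point C u ++ (S ∪ ∅)                       ≡⟨ cong (point C u ++_) (∪-identityʳ S) ⟩
    point C u ++ S                             ∎
    where open ≡-Reasoning

  point-with : ∀ u → point stacked (true ∷ u) ≡ point C u ++ (S ∪ T)
  point-with u = begin
    (base C ++ S) ∪ ((∅ ++ T) ∪ ⋃[ stacked-block ∘ suc ] u)
      ≡⟨ cong (λ X → (base C ++ S) ∪ ((∅ ++ T) ∪ X)) (⋃-++∅ (block C) u) ⟩
    (base C ++ S) ∪ ((∅ ++ T) ∪ (⋃[ block C ] u ++ ∅))
      ≡⟨ cong ((base C ++ S) ∪_) (∪-++ ∅ _ T ∅) ⟩
    (base C ++ S) ∪ ((∅ ∪ ⋃[ block C ] u) ++ (T ∪ ∅))
      ≡⟨ cong₂ (λ X Y → (base C ++ S) ∪ (X ++ Y)) (∪-identityˡ _) (∪-identityʳ T) ⟩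
    (base C ++ S) ∪ (⋃[ block C ] u ++ T)
      ≡⟨ ∪-++ (base C) _ S T ⟩
    point C u ++ (S ∪ T)
      ∎
    where open ≡-Reasoning

⟪_⟫ : ∀ {n} {P : Fin n → Set} → Decidable P → Subset n
⟪ P? ⟫ = tabulate (does ∘ P?)

∈⟪⟫⁺ : ∀ {n} {P : Fin n → Set} (P? : Decidable P) {a} → P a → a ∈ ⟪ P? ⟫
∈⟪⟫⁺ P? {a} p = lookup⇒[]= a _ (trans (lookup∘tabulate (does ∘ P?) a) (dec-true (P? a) p))

∈⟪⟫⁻ : ∀ {n} {P : Fin n → Set} (P? : Decidable P) {a} → a ∈ ⟪ P? ⟫ → P a
∈⟪⟫⁻ P? {a} a∈ with P? a | trans (sym (lookup∘tabulate (does ∘ P?) a)) ([]=⇒lookup a∈)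
... | yes p | _ = p
... | no _  | ()

below? : ∀ {R} (i : ℕ) → Decidable (λ (a : Fin R) → toℕ a < i)
below? i a = toℕ a <? i

between? : ∀ {R} (i j : ℕ) → Decidable (λ (a : Fin R) → i ≤ toℕ a × toℕ a < j)
between? i j a = (i ≤? toℕ a) ×-dec (toℕ a <? j)

segment : ∀ {R} → ℕ → Subset R
segment i = ⟪ below? i ⟫

interval : ∀ {R} → ℕ → ℕ → Subset R
interval i j = ⟪ between? i j ⟫

segment-disjoint : ∀ {R} i j → Disjoint (segment {R} i) (interval i j)
segment-disjoint i j p q = <-irrefl refl (<-≤-trans (∈⟪⟫⁻ (below? i) p) (proj₁ (∈⟪⟫⁻ (between? i j) q)))

segment-∪-interval : ∀ {R i j} → i ≤ j → segment {R} i ∪ interval i j ≡ segment j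
segment-∪-interval {R} {i} {j} i≤j = ⊆-antisym ⊆ ⊇
  where
  ⊆ : ∀ {a} → a ∈ segment i ∪ interval i j → a ∈ segment j
  ⊆ p with x∈p∪q⁻ (segment i) _ p
  ... | inj₁ a<i = ∈⟪⟫⁺ (below? j) (<-≤-trans (∈⟪⟫⁻ (below? i) a<i) i≤j)
  ... | inj₂ a∈I = ∈⟪⟫⁺ (below? j) (proj₂ (∈⟪⟫⁻ (between? i j) a∈I))
  ⊇ : ∀ {a} → a ∈ segment j → a ∈ segment i ∪ interval i j
  ⊇ {a} p with below? i a
  ... | yes a<i = x∈p∪q⁺ (inj₁ (∈⟪⟫⁺ (below? i) a<i))
  ... | no a≮i  = x∈p∪q⁺ (inj₂ (∈⟪⟫⁺ (between? i j) (≮⇒≥ a≮i , ∈⟪⟫⁻ (below? j) p)))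

interval-nonempty : ∀ {R i j} → i < j → j ≤ R → Nonempty (interval {R} i j)
interval-nonempty {R} {i} {j} i<j j≤R =
  a , ∈⟪⟫⁺ (between? i j) (≤-reflexive (sym toℕa≡i) , subst (_< j) (sym toℕa≡i) i<j)
  where
  a = fromℕ< (<-≤-trans i<j j≤R)
  toℕa≡i = toℕ-fromℕ< (<-≤-trans i<j j≤R)

-- Colour Y ⊆ Fin R by its profile, the code of
-- X ↦ c (X ++ Y); two of the R + 1 initial segments, S = segment i ⊂ segment j, share
-- a profile.  Stacking a monochromatic cube for X ↦ c (X ++ S) over S, with the new
-- block interval i j, gives a monochromatic cube of one more dimension.
module CubeStep {d r n : ℕ} (bound : CubeBound d r n) where

  R : ℕ
  R = r ^ length (allSubsets n)

  record SameColourSegments (c : Subset (n + R) → Fin r) : Set where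
    field
      i j  : ℕ
      i<j  : i < j
      j≤R  : j ≤ R
      same : ∀ X → c (X ++ segment {R} i) ≡ c (X ++ segment j)

  profile : (Subset (n + R) → Fin r) → Subset R → Fin R
  profile c Y = encode (allSubsets n) (λ X → c (X ++ Y))

  sameColourSegments : ∀ c → SameColourSegments c
  sameColourSegments c with pigeonhole (n<1+n R) (profile c ∘ segment {R} ∘ toℕ)
  ... | i , j , i<j , same-profile = record
    { i = toℕ i ; j = toℕ j ; i<j = i<j ; j≤R = s≤s⁻¹ (toℕ<n j)
    ; same = λ X → encode-injective (allSubsets n) _ _ same-profile (∈-allSubsets X) }

  step : CubeBound (suc d) r (n + R)
  step c = stacked , monochromatic
    where
    open SameColourSegments (sameColourSegments c)
    S = segment {R} i
    T = interval {R} i j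
    lower = bound (λ X → c (X ++ S))
    C = proj₁ lower
    open Stack C S T (segment-disjoint i j) (interval-nonempty i<j j≤R)
    open ≡-Reasoning
    monochromatic : Monochromatic c stacked
    monochromatic (false ∷ u) = begin
      c (point stacked (false ∷ u)) ≡⟨ cong c (point-without u) ⟩
      c (point C u ++ S)            ≡⟨ proj₂ lower u ⟩
      c (base C ++ S)               ∎
    monochromatic (true ∷ u) = begin
      c (point stacked (true ∷ u))  ≡⟨ cong c (point-with u) ⟩
      c (point C u ++ (S ∪ T))      ≡⟨ cong (λ Y → c (point C u ++ Y))
                                          (segment-∪-interval (<⇒≤ i<j)) ⟩
      c (point C u ++ segment j)    ≡⟨ sym (same (point C u)) ⟩
      c (point C u ++ S)            ≡⟨ proj₂ lower u ⟩
      c (base C ++ S)               ∎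

cubeLemma : ∀ d r → ∃[ N ] CubeBound d r N
cubeLemma zero    r = 0 , λ c → trivialCube , λ { [] → refl }
  where
  trivialCube : Cube 0 0
  trivialCube = record
    { base = [] ; block = λ () ; blocks = record { nonempty = λ () ; disjoint = λ { {()} } }
    ; base-disjoint = λ () }
cubeLemma (suc d) r with cubeLemma d r
... | n , bound = n + r ^ length (allSubsets n) , CubeStep.step bound

base-disjoint-⋃ : ∀ {N d} (C : Cube N d) u → Disjoint (base C) (⋃[ block C ] u)
base-disjoint-⋃ C u p q with ∈⋃⁻ (block C) u q
... | j , _ , a∈Wj = base-disjoint C j p a∈Wj

module Subcube {N d m : ℕ} (C : Cube N (suc d)) (g : Fin m → Fin d) (g-inj : Injective _≡_ _≡_ g) where

  subcube : Cube N m
  subcube = record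
    { base          = base C ∪ block C zero
    ; block         = block C ∘ suc ∘ g
    ; blocks        = Blocks-∘ (blocks C) (suc ∘ g) (g-inj ∘ Fin.suc-injective)
    ; base-disjoint = λ j → Disjoint-∪ (base-disjoint C (suc (g j))) (disjoint (blocks C) (λ ())) }

  subcube-base-nonempty : Nonempty (base subcube)
  subcube-base-nonempty = proj₁ (nonempty (blocks C) zero) , x∈p∪q⁺ (inj₂ (proj₂ (nonempty (blocks C) zero)))

  point-subcube : ∀ u → point subcube u ≡ point C (true ∷ ⋃[ ⁅_⁆ ∘ g ] u)
  point-subcube u = begin
    (base C ∪ block C zero) ∪ ⋃[ block C ∘ suc ∘ g ] u
      ≡⟨ ∪-assoc (base C) _ _ ⟩
    base C ∪ (block C zero ∪ ⋃[ block C ∘ suc ∘ g ] u)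
      ≡⟨ cong (λ X → base C ∪ (block C zero ∪ X)) selected ⟩
    base C ∪ (block C zero ∪ ⋃[ block C ∘ suc ] (⋃[ ⁅_⁆ ∘ g ] u))
      ∎
    where
    open ≡-Reasoning
    selected : ⋃[ block C ∘ suc ∘ g ] u ≡ ⋃[ block C ∘ suc ] (⋃[ ⁅_⁆ ∘ g ] u)
    selected = trans (⋃-cong (λ j → sym (⋃-⁅⁆ (block C ∘ suc) (g j))) u)
                     (⋃-⋃ (block C ∘ suc) (⁅_⁆ ∘ g) u)

  subcube-colour : ∀ {r} (c : Subset N → Fin r) → Monochromatic c C →
                   ∀ u → c (point subcube u) ≡ c (base C)
  subcube-colour c C-mono u = trans (cong c (point-subcube u)) (C-mono (true ∷ ⋃[ ⁅_⁆ ∘ g ] u))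

record Homogeneous {N r : ℕ} (c : Subset N → Fin r) (x : Fin r) (k : ℕ) : Set where
  constructor homogeneous
  field
    hblock         : Fin k → Subset N
    hblocks        : Blocks hblock
    unions-colour  : ∀ v → Nonempty v → c (⋃[ hblock ] v) ≡ x

noBlocks : ∀ {N r} {c : Subset N → Fin r} {x} → Homogeneous c x 0
noBlocks = homogeneous (λ ()) (record { nonempty = λ () ; disjoint = λ { {()} } }) (λ { [] (() , _) })

lift : ∀ {N m r} {c : Subset N → Fin r} {x k} {W : Fin m → Subset N} →
       Blocks W → Homogeneous (c ∘ ⋃[ W ]_) x k → Homogeneous c x k
lift {c = c} {W = W} bW (homogeneous Y bY hY) =
  homogeneous (⋃[ W ]_ ∘ Y) (Blocks-⋃ bW bY) (λ v v≠∅ → trans (cong c (⋃-⋃ W Y v)) (hY v v≠∅))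

extend : ∀ {N m r} {c : Subset N → Fin r} {x k} (C : Cube N m) →
         Nonempty (base C) → (∀ u → c (point C u) ≡ x) →
         Homogeneous (c ∘ ⋃[ block C ]_) x k → Homogeneous c x (suc k)
extend {c = c} {x} {k} C base≠∅ C-colour (homogeneous Y bY hY) =
  homogeneous W (record { nonempty = ne ; disjoint = apart }) colour′
  where
  W : Fin (suc k) → Subset _
  W zero    = base C
  W (suc j) = ⋃[ block C ] (Y j)
  ne : ∀ j → Nonempty (W j)
  ne zero    = base≠∅
  ne (suc j) = ⋃-nonempty (blocks C) (nonempty bY j)
  apart : ∀ {i j} → i ≢ j → Disjoint (W i) (W j)
  apart {zero}  {zero}  i≢j = ⊥-elim (i≢j refl)
  apart {zero}  {suc j} _   = base-disjoint-⋃ C (Y j)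
  apart {suc i} {zero}  _   = Disjoint-sym (base-disjoint-⋃ C (Y i))
  apart {suc i} {suc j} i≢j = disjoint (Blocks-⋃ (blocks C) bY) (i≢j ∘ cong suc)
  colour′ : ∀ v → Nonempty v → c (⋃[ W ] v) ≡ x
  -- unions containing the base are points of C; the others are unions of the Y-blocks
  colour′ (true ∷ v)  _ =
    trans (cong (λ X → c (base C ∪ X)) (⋃-⋃ (block C) Y v)) (C-colour (⋃[ Y ] v))
  colour′ (false ∷ v) (suc j , there j∈v) =
    trans (cong c (⋃-⋃ (block C) Y v)) (hY v (j , j∈v))

FolkmanBound : ℕ → ℕ → ℕ → Set
FolkmanBound a b N = (c : Subset N → Fin 2) → Homogeneous c zero a ⊎ Homogeneous c (suc zero) b

-- Take a monochromatic cube with 1 + N₁ + N₂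
-- blocks; merge its first block into the base and keep either the first N₁ or the
-- last N₂ remaining blocks, according to the colour of the base.  On the kept
-- blocks apply the induction hypothesis: an answer of the base's colour is extended
-- by the base, an answer of the other colour lifts directly.
folkmanStep : ∀ {a b N₁ N₂ N} → FolkmanBound a (suc b) N₁ → FolkmanBound (suc a) b N₂ →
              CubeBound (suc (N₁ + N₂)) 2 N → FolkmanBound (suc a) (suc b) N
folkmanStep {N₁ = N₁} {N₂} bound₁ bound₂ cubes c = byBaseColour (c (base C)) refl
  where
  C = proj₁ (cubes c)
  C-mono = proj₂ (cubes c)
  module Left  = Subcube C (_↑ˡ N₂) (↑ˡ-injective N₂ _ _)
  module Right = Subcube C (N₁ ↑ʳ_) (↑ʳ-injective N₁ _ _)
  byBaseColour : ∀ x → c (base C) ≡ x → Homogeneous c zero (suc _) ⊎ Homogeneous c (suc zero) (suc _)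
  byBaseColour zero e with bound₁ (c ∘ ⋃[ block Left.subcube ]_)
  ... | inj₁ H = inj₁ (extend Left.subcube Left.subcube-base-nonempty
                         (λ u → trans (Left.subcube-colour c C-mono u) e) H)
  ... | inj₂ H = inj₂ (lift (blocks Left.subcube) H)
  byBaseColour (suc zero) e with bound₂ (c ∘ ⋃[ block Right.subcube ]_)
  ... | inj₁ H = inj₁ (lift (blocks Right.subcube) H)
  ... | inj₂ H = inj₂ (extend Right.subcube Right.subcube-base-nonempty
                         (λ u → trans (Right.subcube-colour c C-mono u) e) H)

folkman : ∀ a b → ∃[ N ] FolkmanBound a b N
folkman zero    b       = 0 , λ c → inj₁ noBlocks
folkman (suc a) zero    = 0 , λ c → inj₂ noBlocks
folkman (suc a) (suc b) with folkman a (suc b) | folkman (suc a) b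
... | N₁ , bound₁ | N₂ , bound₂ with cubeLemma (suc (N₁ + N₂)) 2
...   | N , cubes = N , folkmanStep bound₁ bound₂ cubes

∈⇒≤sum : ∀ {k xs} → k List.∈ xs → k ≤ sum xs
∈⇒≤sum {xs = x ∷ xs} (Any.here refl) = m≤m+n x (sum xs)
∈⇒≤sum {xs = x ∷ xs} (Any.there p)   = ≤-trans (∈⇒≤sum p) (m≤n+m (sum xs) x)

singleton : ℕ → 𝔽
singleton n = mkF n [] [-]

IsUnion-⁅⁆ : ∀ {K} (t : Fin K → 𝔽) (i : Fin K) → IsUnion t (_∈ ⁅ i ⁆) (t i)
IsUnion-⁅⁆ t i k = mk⇔ (λ k∈ti → i , x∈⁅x⁆ i , k∈ti)
                       (λ { (j , j∈⁅i⁆ , k∈tj) → subst (λ j → k ∈F t j) (x∈⁅y⁆⇒x≡y i j∈⁅i⁆) k∈tj })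

IsUnion-⋃ : ∀ {N k} {t : Fin N → 𝔽} {t′ : Fin k → 𝔽} (W : Fin k → Subset N) (V : Subset k) {z : 𝔽} →
            (∀ j → IsUnion t (_∈ W j) (t′ j)) → IsUnion t′ (_∈ V) z → IsUnion t (_∈ ⋃[ W ] V) z
IsUnion-⋃ {t = t} {t′} W V t′=⋃ z=⋃ k =
  mk⇔ (λ k∈z → down (to (z=⋃ k) k∈z)) (λ p → from (z=⋃ k) (up p))
  where
  down : Σ (Fin _) (λ j → j ∈ V × k ∈F t′ j) → Σ (Fin _) (λ a → a ∈ ⋃[ W ] V × k ∈F t a)
  down (j , j∈V , k∈t′j) with to (t′=⋃ j k) k∈t′j
  ... | a , a∈Wj , k∈ta = a , ∈⋃⁺ W j∈V a∈Wj , k∈ta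
  up : Σ (Fin _) (λ a → a ∈ ⋃[ W ] V × k ∈F t a) → Σ (Fin _) (λ j → j ∈ V × k ∈F t′ j)
  up (a , a∈⋃ , k∈ta) with ∈⋃⁻ W V a∈⋃
  ... | j , j∈V , a∈Wj = j , j∈V , from (t′=⋃ j k) (a , a∈Wj , k∈ta)

IsUnion-reindex : ∀ {K} (x : ℕ → 𝔽) (f : Fin K → ℕ) {V : Subset K} {v z : 𝔽} →
                  IsUnion (singleton ∘ f) (_∈ V) v → IsUnion (x ∘ f) (_∈ V) z → IsUnion x (_∈F v) z
IsUnion-reindex {K} x f {V} {v} v=f[V] z=⋃ k =
  mk⇔ (λ k∈z → out (to (z=⋃ k) k∈z)) (λ p → from (z=⋃ k) (back p))
  where
  out : Σ (Fin K) (λ i → i ∈ V × k ∈F x (f i)) → Σ ℕ (λ p → p ∈F v × k ∈F x p)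
  out (i , i∈V , k∈xfi) = f i , from (v=f[V] (f i)) (i , i∈V , Any.here refl) , k∈xfi
  back : Σ ℕ (λ p → p ∈F v × k ∈F x p) → Σ (Fin K) (λ i → i ∈ V × k ∈F x (f i))
  back (p , p∈v , k∈xp) with to (v=f[V] p) p∈v
  ... | i , i∈V , Any.here refl = i , i∈V , k∈xp

_∖_ : SubsetF → SubsetF → SubsetF
(A ∖ B) z = A z × ¬ B z

fromSortedList : ∀ {P : ℕ → Set} (xs : List ℕ) → AllPairs _<_ xs → (∀ {k} → (k List.∈ xs) ⇔ P k) →
                 ∀ {k₀} → P k₀ → Σ 𝔽 λ z → ∀ k → (k ∈F z) ⇔ P k
fromSortedList []       _      xs=P P[k₀] = ⊥-elim (¬Any[] (from xs=P P[k₀]))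
fromSortedList (x ∷ xs) sorted xs=P _     = mkF x xs (AllPairs⇒Linked sorted) , λ k → xs=P

-- The theory of s-meshed sets, for a fixed sequence s of pairwise disjoint sets.
-- Classical logic is used to form finite unions and to decide membership in
-- arbitrary subsets of 𝔽.
module Meshed (em : ExcludedMiddle 0ℓ) (s : ℕ → 𝔽) (s-disjoint : PairwiseDisjoint s) where

  dne : ∀ {P : Set} → ¬ ¬ P → P
  dne = em⇒dne em

  finiteSet : (P : ℕ → Set) (B : ℕ) → (∀ {k} → P k → k < B) → ∀ {k₀} → P k₀ →
              Σ 𝔽 λ z → ∀ k → (k ∈F z) ⇔ P k
  finiteSet P B bounded = fromSortedList (List.filter P? (List.upTo B))
    (filter⁺ P? (applyUpTo⁺₁ id B (λ i<j _ → i<j)))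
    (mk⇔ (proj₂ ∘ ∈-filter⁻ P? {xs = List.upTo B}) (λ Pk → ∈-filter⁺ P? (∈-upTo⁺ (bounded Pk)) Pk))
    where
    P? : Decidable P
    P? k = em {P k}

  union : ∀ {K} (t : Fin K → 𝔽) (V : Subset K) → Nonempty V → Σ 𝔽 (IsUnion t (_∈ V))
  union {K} t V (i₀ , i₀∈V) =
    finiteSet (λ k → Σ (Fin K) λ i → i ∈ V × k ∈F t i) (suc total) bounded (i₀ , i₀∈V , Any.here refl)
    where
    total = sum (List.tabulate (λ i → sum (elems (t i))))
    bounded : ∀ {k} → Σ (Fin K) (λ i → i ∈ V × k ∈F t i) → k < suc total
    bounded (i , _ , k∈ti) = s≤s (≤-trans (∈⇒≤sum k∈ti) (∈⇒≤sum (∈-tabulate⁺ i)))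

  Witness : SubsetF → ∀ {n} → (Fin n → 𝔽) → Set
  Witness A t = PairwiseDisjoint t × ((z : 𝔽) → InFUFin t z → InFU s z × A z) × CompleteMeshGraph s t

  HasWitness : SubsetF → ℕ → Set
  HasWitness A n = Σ (Fin n → 𝔽) (Witness A)

  -- If s_n ⊆ x ⊆ y and y ∈ FU(s), then s_n ⊆ y: the least element of s_n lies in y,
  -- so in some s_p with p in the index set of y, and disjointness forces p = n.
  ⊆[s]-mono : ∀ n x y → n ⊆[ s ] x → (∀ {k} → k ∈F x → k ∈F y) → InFU s y → n ⊆[ s ] y
  ⊆[s]-mono n x y (v , x=⋃v , n∈v) x⊆y (w , y=⋃w) = w , y=⋃w , n∈w
    where
    n∈w : n ∈F w
    n∈w with to (y=⋃w (hd (s n))) (x⊆y (from (x=⋃v (hd (s n))) (n , n∈v , Any.here refl)))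
    ... | p , p∈w , h∈sp with p ℕ.≟ n
    ...   | yes refl = p∈w
    ...   | no p≢n   = ⊥-elim (s-disjoint p n p≢n (hd (s n)) h∈sp (Any.here refl))

  -- Coarsening: merging the members of a witness along a family of blocks W gives a
  -- witness again.  Its FU-set consists of unions of t over sets ⋃[ W ] v, so it lies
  -- in any Q containing those unions that belong to A.
  coarsen : ∀ {N k} {A Q : SubsetF} (t : Fin N → 𝔽) → Witness A t →
            (W : Fin k → Subset N) → Blocks W →
            (∀ v → Nonempty v → ∀ z → IsUnion t (_∈ ⋃[ W ] v) z → A z → Q z) → HasWitness Q k
  coarsen {k = k} {Q = Q} t (t-disjoint , t-FU , t-mesh) W bW A⇒Q = t′ , disjoint′ , FU′ , mesh′
    where
    t′ : Fin k → 𝔽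
    t′ j = proj₁ (union t (W j) (nonempty bW j))
    t′=⋃ : ∀ j → IsUnion t (_∈ W j) (t′ j)
    t′=⋃ j = proj₂ (union t (W j) (nonempty bW j))
    t⊆t′ : ∀ j {a k} → a ∈ W j → k ∈F t a → k ∈F t′ j
    t⊆t′ j {a} {k} a∈Wj k∈ta = from (t′=⋃ j k) (a , a∈Wj , k∈ta)

    disjoint′ : PairwiseDisjoint t′
    disjoint′ i j i≢j k k∈t′i k∈t′j with to (t′=⋃ i k) k∈t′i | to (t′=⋃ j k) k∈t′j
    ... | a , a∈Wi , k∈ta | b , b∈Wj , k∈tb with a Fin.≟ b
    ...   | yes refl = disjoint bW i≢j a∈Wi b∈Wj
    ...   | no a≢b   = t-disjoint a b a≢b k k∈ta k∈tb

    FU′ : (z : 𝔽) → InFUFin t′ z → InFU s z × Q z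
    FU′ z (V , V≠∅ , z=⋃) = proj₁ z∈ , A⇒Q V V≠∅ z z=⋃⋃ (proj₂ z∈)
      where
      z=⋃⋃ : IsUnion t (_∈ ⋃[ W ] V) z
      z=⋃⋃ = IsUnion-⋃ {t = t} {t′} W V {z} t′=⋃ z=⋃
      z∈ = t-FU z (⋃[ W ] V , ⋃-nonempty bW V≠∅ , z=⋃⋃)

    t′∈FU : ∀ j → InFU s (t′ j)
    t′∈FU j = proj₁ (t-FU (t′ j) (W j , nonempty bW j , t′=⋃ j))

    -- Members of distinct blocks are distinct, so meshing pieces of them carry over.
    mesh′ : CompleteMeshGraph s t′
    mesh′ i j i≢j = lift-edge (t-mesh a b a≢b)
      where
      a = proj₁ (nonempty bW i)
      b = proj₁ (nonempty bW j)
      a≢b : a ≢ b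
      a≢b a≡b = disjoint bW i≢j (proj₂ (nonempty bW i)) (subst (_∈ W j) (sym a≡b) (proj₂ (nonempty bW j)))
      lift-edge : Σ ℕ (λ n → Σ ℕ (λ m → n ⊆[ s ] t a × m ⊆[ s ] t b × (s n ⊓ s m))) →
                  Σ ℕ (λ n → Σ ℕ (λ m → n ⊆[ s ] t′ i × m ⊆[ s ] t′ j × (s n ⊓ s m)))
      lift-edge (n , m , n⊆ta , m⊆tb , n⊓m) =
        n , m , ⊆[s]-mono n (t a) (t′ i) n⊆ta (t⊆t′ i (proj₂ (nonempty bW i))) (t′∈FU i)
              , ⊆[s]-mono m (t b) (t′ j) m⊆tb (t⊆t′ j (proj₂ (nonempty bW j))) (t′∈FU j) , n⊓m

  subsequence : ∀ {m n A} (h : Fin n → Fin m) → Injective _≡_ _≡_ h → HasWitness A m → HasWitness A n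
  subsequence h h-inj (t , w) = coarsen t w (⁅_⁆ ∘ h) (Blocks-⁅⁆ h h-inj) (λ _ _ _ _ Az → Az)

  meshed-mono : ∀ {A B : SubsetF} → A ⊆ˢ B → IsMeshed s A → IsMeshed s B
  meshed-mono A⊆B M n with M n
  ... | t , t-disjoint , t-FU , t-mesh =
    t , t-disjoint , (λ z z∈ → proj₁ (t-FU z z∈) , A⊆B z (proj₂ (t-FU z z∈))) , t-mesh

  -- An s-meshed set is nonempty: the single member of a witness of length 1 lies in it.
  meshed-nonempty : ∀ {A} → IsMeshed s A → Σ 𝔽 A
  meshed-nonempty M with M 1
  ... | t , _ , t-FU , _ = t zero , proj₂ (t-FU (t zero) (⁅ zero ⁆ , (zero , x∈⁅x⁆ zero) , IsUnion-⁅⁆ t zero))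

  -- A strictly increasing selection of s whose meshing graph is complete is a
  -- witness for 𝔽: the index set of a union over V ⊆ Fin K is { f i | i ∈ V }.
  selectionWitness : ∀ {K} (f : Fin K → ℕ) → StrictlyIncreasing f → CompleteMeshGraph s (s ∘ f) →
                     Witness (λ _ → ⊤) (s ∘ f)
  selectionWitness f f-increasing f-mesh = disjoint′ , FU′ , f-mesh
    where
    f-injective : Injective _≡_ _≡_ f
    f-injective {i} {j} fi≡fj with Fin.<-cmp i j
    ... | tri< i<j _ _ = ⊥-elim (<-irrefl fi≡fj (f-increasing i j i<j))
    ... | tri≈ _ i≡j _ = i≡j
    ... | tri> _ _ j<i = ⊥-elim (<-irrefl (sym fi≡fj) (f-increasing j i j<i))
    disjoint′ : PairwiseDisjoint (s ∘ f)
    disjoint′ i j i≢j = s-disjoint (f i) (f j) (i≢j ∘ f-injective)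
    FU′ : (z : 𝔽) → InFUFin (s ∘ f) z → InFU s z × ⊤
    FU′ z (V , V≠∅ , z=⋃) =
      (proj₁ indices , IsUnion-reindex s f {V = V} {v = proj₁ indices} {z = z} (proj₂ indices) z=⋃) , tt
      where indices = union (singleton ∘ f) V V≠∅

  wholeMeshed : ((n : ℕ) → Σ (Fin (suc n) → ℕ) (λ f → StrictlyIncreasing f × CompleteMeshGraph s (s ∘ f))) →
                IsMeshed s (λ _ → ⊤)
  wholeMeshed complete n with complete n
  ... | f , f-increasing , f-mesh =
    subsequence inject₁ Fin.inject₁-injective (s ∘ f , selectionWitness f f-increasing f-mesh)

  -- Colour V ⊆ Fin N by whether all unions
  -- of t over V lie in A₀; Folkman's theorem gives k blocks whose nonempty unions all
  -- lie in A₀, or all lie outside A₀ and hence in A₁; coarsening along them yields a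
  -- witness of length k for A₀ or for A₁.
  split : ∀ {A A₀ A₁ : SubsetF} → (∀ z → A z ⇔ (A₀ z ⊎ A₁ z)) → IsMeshed s A →
          ∀ k → HasWitness A₀ k ⊎ HasWitness A₁ k
  split {A} {A₀} {A₁} A=A₀∪A₁ M k = byFolkman (proj₂ (folkman k k) colour)
    where
    N = proj₁ (folkman k k)
    t = proj₁ (M N)
    w = proj₂ (M N)

    UnionsIn₀ : Subset N → Set
    UnionsIn₀ V = ∀ z → IsUnion t (_∈ V) z → A₀ z

    colour : Subset N → Fin 2
    colour V with em {UnionsIn₀ V}
    ... | yes _ = zero
    ... | no _  = suc zero

    colour-zero : ∀ V → colour V ≡ zero → UnionsIn₀ V
    colour-zero V _  with em {UnionsIn₀ V}
    colour-zero V _  | yes in₀ = in₀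
    colour-zero V () | no _

    colour-one : ∀ V → colour V ≡ suc zero → ¬ UnionsIn₀ V
    colour-one V _  with em {UnionsIn₀ V}
    colour-one V () | yes _
    colour-one V _  | no ¬in₀ = ¬in₀

    byFolkman : Homogeneous colour zero k ⊎ Homogeneous colour (suc zero) k → HasWitness A₀ k ⊎ HasWitness A₁ k
    byFolkman (inj₁ (homogeneous W bW hW)) =
      inj₁ (coarsen t w W bW (λ v v≠∅ z z=⋃ _ → colour-zero _ (hW v v≠∅) z z=⋃))
    byFolkman (inj₂ (homogeneous W bW hW)) = inj₂ (coarsen t w W bW in₁)
      where
      in₁ : ∀ v → Nonempty v → ∀ z → IsUnion t (_∈ ⋃[ W ] v) z → A z → A₁ z
      in₁ v v≠∅ z z=⋃ Az with to (A=A₀∪A₁ z) Az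
      ... | inj₂ A₁z = A₁z
      ... | inj₁ A₀z = ⊥-elim (colour-one _ (hW v v≠∅) λ z′ z′=⋃ →
                                 subst A₀ (IsUnion-unique {x = t} z=⋃ z′=⋃) A₀z)

  -- Being s-meshed is partition regular.  If A₀ is not s-meshed, some length n₀ has no
  -- A₀-witness; splitting witnesses of length n + n₀ then always yields A₁-witnesses.
  partitionRegular : (A A₀ A₁ : SubsetF) → ((z : 𝔽) → A z ⇔ (A₀ z ⊎ A₁ z)) →
                     IsMeshed s A → IsMeshed s A₀ ⊎ IsMeshed s A₁
  partitionRegular A A₀ A₁ A=A₀∪A₁ M with em {IsMeshed s A₀}
  ... | yes M₀ = inj₁ M₀
  ... | no ¬M₀ = inj₂ M₁
    where
    gap : ∃[ n₀ ] ¬ HasWitness A₀ n₀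
    gap = dne (λ ¬gap → ¬M₀ (λ n → dne (λ ¬w → ¬gap (n , ¬w))))
    M₁ : IsMeshed s A₁
    M₁ n with split A=A₀∪A₁ M (n + proj₁ gap)
    ... | inj₁ w₀ = ⊥-elim (proj₂ gap (subsequence (n ↑ʳ_) (↑ʳ-injective n _ _) w₀))
    ... | inj₂ w₁ = subsequence (_↑ˡ proj₁ gap) (↑ˡ-injective (proj₁ gap) _ _) w₁

  -- Sets B such that A ∖ B is not s-meshed form a filter (by partition regularity);
  -- an ultrafilter extending it contains A, and all its members are s-meshed.
  meshedUltrafilter : UltrafilterLemma → (A : SubsetF) → IsMeshed s A →
    Σ (SubsetF → Set) (λ U → IsUltrafilter U × U A × ((B : SubsetF) → U B → IsMeshed s B))
  meshedUltrafilter ultrafilterLemma A M = fromUltrafilter (ultrafilterLemma Φ Φ-filter)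
    where
    Φ : SubsetF → Set
    Φ B = ¬ IsMeshed s (A ∖ B)

    A∖A-unmeshed : Φ A
    A∖A-unmeshed M′ with meshed-nonempty M′
    ... | z , Az , ¬Az = ¬Az Az

    ∖-∩ : (B C : SubsetF) (z : 𝔽) → (A ∖ (B ∩ˢ C)) z ⇔ ((A ∖ B) z ⊎ (A ∖ C) z)
    ∖-∩ B C z = mk⇔ divide join
      where
      divide : (A ∖ (B ∩ˢ C)) z → (A ∖ B) z ⊎ (A ∖ C) z
      divide (Az , ¬BCz) with em {B z}
      ... | yes Bz = inj₂ (Az , λ Cz → ¬BCz (Bz , Cz))
      ... | no ¬Bz = inj₁ (Az , ¬Bz)
      join : (A ∖ B) z ⊎ (A ∖ C) z → (A ∖ (B ∩ˢ C)) z
      join (inj₁ (Az , ¬Bz)) = Az , ¬Bz ∘ proj₁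
      join (inj₂ (Az , ¬Cz)) = Az , ¬Cz ∘ proj₂

    Φ-filter : IsFilter Φ
    Φ-filter = record
      { full   = λ M′ → proj₂ (proj₂ (meshed-nonempty M′)) tt
      ; proper = λ ¬M → ¬M (meshed-mono (λ z Az → Az , λ ()) M)
      ; inter  = λ B C ΦB ΦC M′ → [ ΦB , ΦC ] (partitionRegular _ _ _ (∖-∩ B C) M′)
      ; upward = λ B C B⊆C ΦB M′ → ΦB (meshed-mono (λ z → map₂ (_∘ B⊆C z)) M′) }

    fromUltrafilter : Σ (SubsetF → Set) (λ U → IsUltrafilter U × ((B : SubsetF) → Φ B → U B)) →
                      Σ (SubsetF → Set) (λ U → IsUltrafilter U × U A × ((B : SubsetF) → U B → IsMeshed s B))
    fromUltrafilter (U , U-ultra , Φ⊆U) = U , U-ultra , Φ⊆U A A∖A-unmeshed , U-meshed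
      where
      open IsFilter (proj₁ U-ultra)
      -- If B ∈ U were not s-meshed, then A ∖ ∁B ⊆ B would not be either, so ∁B ∈ U too.
      U-meshed : (B : SubsetF) → U B → IsMeshed s B
      U-meshed B UB = dne λ ¬MB →
        let U∁B = Φ⊆U (∁ˢ B) (λ M′ → ¬MB (meshed-mono (λ z A∖∁B → dne (proj₂ A∖∁B)) M′))
        in proper (upward (B ∩ˢ ∁ˢ B) (λ _ → ⊥) (λ z B∁B → proj₂ B∁B (proj₁ B∁B))
                          (inter B (∁ˢ B) UB U∁B))

mainTheorem7 : ExcludedMiddle 0ℓ → UltrafilterLemma →
    (s : ℕ → 𝔽) → PairwiseDisjoint s →
    ((n : ℕ) → Σ (Fin (suc n) → ℕ) (λ f → StrictlyIncreasing f × CompleteMeshGraph s (s ∘ f))) →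
    IsMeshed s (λ _ → ⊤)
    × ((A A₀ A₁ : SubsetF) → ((z : 𝔽) → A z ⇔ (A₀ z ⊎ A₁ z)) →
        IsMeshed s A → IsMeshed s A₀ ⊎ IsMeshed s A₁)
    × ((A : SubsetF) → IsMeshed s A →
        Σ (SubsetF → Set) (λ U → IsUltrafilter U × U A × ((B : SubsetF) → U B → IsMeshed s B)))
mainTheorem7 em ultrafilterLemma s s-disjoint complete =
  wholeMeshed complete , partitionRegular , meshedUltrafilter ultrafilterLemma
  where open Meshed em s s-disjoint
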